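{- Let $n=2m>3$ be an even integer and let $a,b$ be natural numbers with $1\le a<b\le n-1$. If one of $a,b$ is even and the other is odd, then $a$ and $b$ do not induce an $n$-polygon with $m$ axes, i.e. the $n$-tuple of sides $(a,b,a,b,\ldots,a,b)$ does not represent an $n$-polygon with $m$ axes.
   Context: Fix the vertices $v_k=e^{2\pi i k/n}$, $k=0,\ldots,n-1$, on the unit circle. An $n$-polygon is a Hamiltonian cycle through these vertices: a closed path $v_{\sigma_1}\cdots v_{\sigma_n}v_{\sigma_1}$ of straight segments with $(\sigma_1,\ldots,\sigma_n)$ an ordering of $0,\ldots,n-1$. Its sides are the integers $e_i\in\{1,\ldots,n-1\}$ with $e_i\equiv\sigma_{i+1}-\sigma_i\pmod n$; an $n$-tuple of sides represents a polygon if starting at a vertex and moving counterclockwise successively by the sides visits each vertex exactly once before returning to the start after the $n$-th step. An $n$-polygon with $m$ axes is one with exactly $m$ axes of reflection symmetry. -}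

module Defs where

open import Data.Nat using (ℕ; zero; suc; _+_; _*_; _∸_; _≤_; _<_; _≡ᵇ_; _%_)
open import Data.Bool using (Bool; true; false; _∧_; _∨_; if_then_else_)
open import Data.Fin using (Fin; toℕ)
open import Data.List using (List; map; take; allFin; length; filterᵇ)
open import Data.Nat.ListAction using (sum)
open import Data.Bool.ListAction using (all; any)
open import Data.Product using (_×_; _,_)
open import Relation.Binary.PropositionalEquality using (_≡_)

-- reduction modulo n (n ≥ 1 in all uses; the zero case is a dummy)
modN : ℕ → ℕ → ℕ
modN zero    x = x
modN (suc k) x = x % suc k

Sides : ℕ → Set
Sides n = Fin n → ℕ

psum : ∀ {n} → Sides n → ℕ → ℕ
psum {n} e k = sum (map e (take k (allFin n)))

-- index of the vertex reached after k steps, starting at v_0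
pos : ∀ {n} → Sides n → ℕ → ℕ
pos {n} e k = modN n (psum e k)

IsPolygon : (n : ℕ) → Sides n → Set
IsPolygon n e =
  (∀ i → (1 ≤ e i) × (e i < n))
  × (∀ (j k : Fin n) → pos e (toℕ j) ≡ pos e (toℕ k) → j ≡ k)
  × (pos e n ≡ 0)

edge : ∀ {n} → Sides n → Fin n → ℕ × ℕ
edge e k = pos e (toℕ k) , pos e (suc (toℕ k))

sameEdge : ℕ × ℕ → ℕ × ℕ → Bool
sameEdge (x , y) (u , v) = ((x ≡ᵇ u) ∧ (y ≡ᵇ v)) ∨ ((x ≡ᵇ v) ∧ (y ≡ᵇ u))

-- the reflection of the plane fixing the unit circle that maps v_x to v_{c-x};
-- c = 0,…,n-1 gives the n distinct reflection axes of the regular n-gon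
reflect : ℕ → ℕ → ℕ → ℕ
reflect n c x = modN n (c + n ∸ x)

reflectEdge : ℕ → ℕ → ℕ × ℕ → ℕ × ℕ
reflectEdge n c (x , y) = reflect n c x , reflect n c y

isAxis : (n : ℕ) → Sides n → Fin n → Bool
isAxis n e c =
  all (λ k → any (λ j → sameEdge (reflectEdge n (toℕ c) (edge e k)) (edge e j)) (allFin n))
      (allFin n)

numAxes : (n : ℕ) → Sides n → ℕ
numAxes n e = length (filterᵇ (isAxis n e) (allFin n))

alt : ∀ {n} → ℕ → ℕ → Sides n
alt a b i = if toℕ i % 2 ≡ᵇ 0 then a else b

IsPolygonWithAxes : (n : ℕ) → Sides n → ℕ → Set
IsPolygonWithAxes n e m = IsPolygon n e × (numAxes n e ≡ m)

-- After 2m steps the alternating path has advanced by m(a + b), so it closes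
-- up only if 2m ∣ m(a + b), that is, only if a + b is even. When a and b have
-- opposite parity the tuple (a, b, …, a, b) is therefore not even a polygon.
module Submission where

open import Defs
open import Data.Nat using (ℕ; zero; suc; _+_; _*_; _∸_; _≤_; _<_; _%_; _≡ᵇ_)
open import Data.Nat.Properties using (+-assoc; +-comm; *-comm; +-suc; ≤-reflexive)
open import Data.Nat.DivMod using ([m+n]%n≡m%n)
open import Data.Nat.Divisibility
  using (_∣_; m%n≡0⇒n∣m; ∣m+n∣m⇒∣n; *-cancelˡ-∣)
open import Data.Nat.ListAction using (sum)
open import Data.Bool using (if_then_else_)
open import Data.Fin using (toℕ)
open import Data.List using (map; take; allFin; tabulate; applyUpTo; _∷_)
open import Data.List.Properties using (take-all; map-tabulate; length-tabulate)
open import Data.Product using (_×_; _,_)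
open import Data.Sum using (_⊎_; inj₁; inj₂)
open import Relation.Nullary using (¬_)
open import Relation.Binary.PropositionalEquality
open import Function using (_∘_; id)

tabulate-∘toℕ : ∀ {a} {A : Set a} n (f : ℕ → A) →
  tabulate {n = n} (f ∘ toℕ) ≡ applyUpTo f n
tabulate-∘toℕ zero    f = refl
tabulate-∘toℕ (suc n) f = cong (f 0 ∷_) (tabulate-∘toℕ n (f ∘ suc))

psum-all : ∀ {n} (e : Sides n) → psum e n ≡ sum (tabulate e)
psum-all {n} e = begin
  sum (map e (take n (allFin n)))
    ≡⟨ cong (sum ∘ map e) (take-all n (allFin n) (≤-reflexive (length-tabulate id))) ⟩
  sum (map e (allFin n))
    ≡⟨ cong sum (map-tabulate id e) ⟩
  sum (tabulate e) ∎
  where open ≡-Reasoning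

sum-applyUpTo-2-periodic : ∀ m (f : ℕ → ℕ) → (∀ k → f (2 + k) ≡ f k) →
  sum (applyUpTo f (2 * m)) ≡ m * (f 0 + f 1)
sum-applyUpTo-2-periodic zero    f periodic = refl
sum-applyUpTo-2-periodic (suc m) f periodic rewrite +-suc m (m + 0) = begin
  f 0 + (f 1 + sum (applyUpTo (f ∘ suc ∘ suc) (2 * m)))
    ≡⟨ cong (λ s → f 0 + (f 1 + s))
         (sum-applyUpTo-2-periodic m (f ∘ suc ∘ suc) (periodic ∘ suc ∘ suc)) ⟩
  f 0 + (f 1 + m * (f 2 + f 3))
    ≡⟨ cong₂ (λ x y → f 0 + (f 1 + m * (x + y))) (periodic 0) (periodic 1) ⟩
  f 0 + (f 1 + m * (f 0 + f 1))
    ≡⟨ +-assoc (f 0) (f 1) _ ⟨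
  f 0 + f 1 + m * (f 0 + f 1) ∎
  where open ≡-Reasoning

alternating : ℕ → ℕ → ℕ → ℕ
alternating a b k = if k % 2 ≡ᵇ 0 then a else b

alternating-2-periodic : ∀ a b k → alternating a b (2 + k) ≡ alternating a b k
alternating-2-periodic a b k =
  cong (λ r → if r ≡ᵇ 0 then a else b)
       (trans (cong (_% 2) (+-comm 2 k)) ([m+n]%n≡m%n k 2))

psum-alt : ∀ m a b → psum {2 * m} (alt a b) (2 * m) ≡ m * (a + b)
psum-alt m a b = begin
  psum {2 * m} (alt a b) (2 * m)
    ≡⟨ psum-all {2 * m} (alt a b) ⟩
  sum (tabulate {n = 2 * m} (alternating a b ∘ toℕ))
    ≡⟨ cong sum (tabulate-∘toℕ (2 * m) (alternating a b)) ⟩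
  sum (applyUpTo (alternating a b) (2 * m))
    ≡⟨ sum-applyUpTo-2-periodic m (alternating a b) (alternating-2-periodic a b) ⟩
  m * (a + b) ∎
  where open ≡-Reasoning

pos≡0⇒∣psum : ∀ {n} (e : Sides (suc n)) → pos e (suc n) ≡ 0 → suc n ∣ psum e (suc n)
pos≡0⇒∣psum {n} e = m%n≡0⇒n∣m (psum e (suc n)) (suc n)

alt-closes⇒2∣a+b : ∀ m a b → pos {2 * suc m} (alt a b) (2 * suc m) ≡ 0 → 2 ∣ a + b
alt-closes⇒2∣a+b m a b closes = *-cancelˡ-∣ (suc m)
  (subst₂ _∣_ (*-comm 2 (suc m)) (psum-alt (suc m) a b) (pos≡0⇒∣psum (alt a b) closes))

opposite-parity⇒∤-sum : ∀ a b → ((2 ∣ a) × ¬ (2 ∣ b)) ⊎ (¬ (2 ∣ a) × (2 ∣ b)) →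
  ¬ (2 ∣ a + b)
opposite-parity⇒∤-sum a b (inj₁ (2∣a , 2∤b)) 2∣a+b = 2∤b (∣m+n∣m⇒∣n 2∣a+b 2∣a)
opposite-parity⇒∤-sum a b (inj₂ (2∤a , 2∣b)) 2∣a+b =
  2∤a (∣m+n∣m⇒∣n (subst (2 ∣_) (+-comm a b) 2∣a+b) 2∣b)

theorem3 : (m a b : ℕ) → 3 < 2 * m → 1 ≤ a → a < b → b ≤ 2 * m ∸ 1 →
    ((2 ∣ a) × ¬ (2 ∣ b)) ⊎ (¬ (2 ∣ a) × (2 ∣ b)) →
    ¬ IsPolygonWithAxes (2 * m) (alt a b) m
theorem3 zero    a b () _ _ _ _
theorem3 (suc m) a b _ _ _ _ parity ((_ , _ , closes) , _) =
  opposite-parity⇒∤-sum a b parity (alt-closes⇒2∣a+b m a b closes)
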